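{- Let $H$ be a finite bipartite graph with parts $UB$ and $UD$ in which every vertex of $UD$ has at least one neighbor. Let $sol$ be the optimal value of the linear program $$\min \sum_{v\in UB}x_v\quad\text{s.t.}\quad \sum_{v\in N_H(u)}x_v\ge 1\ (u\in UD),\qquad 0\le x_v\le 1\ (v\in UB).$$ Let $k\ge 1$ and let $f_1,\ldots,f_k:UB\to\mathbb{Z}$ be arbitrary functions. For $j=1,\ldots,k$ define inductively the linear program $LP(f_j)$: $$\min \sum_{v\in UB}f_j(v)x_v\quad\text{s.t.}\quad \sum_{v\in N_H(u)}x_v\ge 1\ (u\in UD),\quad \sum_{v\in UB}x_v=\lceil sol\rceil,\quad \sum_{v\in UB}f_i(v)x_v\ge \lceil sol_i\rceil\ (i\in\{1,\ldots,j-1\}),\quad 0\le x_v\le 1\ (v\in UB),$$ where $sol_i$ denotes the optimal value of $LP(f_i)$, with $sol_i=+\infty$ if $LP(f_i)$ has no feasible solution. If there is some $j\in\{1,\ldots,k\}$ such that $LP(f_j)$ has no feasible solution, then $\gamma_p(H\rightarrow UD)\ge\lceil sol\rceil+1$, i.e. every set $D\subseteq UB$ such that every vertex of $UD$ has a neighbor in $D$ satisfies $|D|\ge \lceil sol\rceil+1$.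
   Context: $N_H(u)$ denotes the set of neighbors of $u$ in $H$. For the bipartite graph $H$ with parts $UB,UD$, a $UD$-PDS is a subset of $UB$ such that every vertex of $UD$ is adjacent to some vertex of it, and $\gamma_p(H\rightarrow UD)$ is the minimum cardinality of such a set.
   Formalization: The variables $x_v$ of the linear program defining $sol$ and of each $LP(f_j)$ are taken over ℚ. -}

module Defs where

open import Data.Nat using (ℕ; zero; suc)
open import Data.Fin using (Fin; zero; suc; toℕ)
open import Data.Bool using (Bool; true; false)
open import Data.Integer as ℤ using (ℤ)
open import Data.Rational as ℚ using (ℚ; 0ℚ; 1ℚ; _≤_; ceiling)
open import Data.Unit using (⊤)
open import Data.Empty using (⊥)
open import Data.Sum using (_⊎_; inj₁; inj₂)
open import Data.Product using (Σ; ∃; _×_; _,_)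
open import Relation.Binary.PropositionalEquality using (_≡_)
open import Relation.Nullary using (¬_)

-- Bipartite graph H with parts UB = Fin m and UD = Fin n,
-- given by adjacency: adj u v ≡ true iff u ∈ UD is adjacent to v ∈ UB.
Adj : ℕ → ℕ → Set
Adj n m = Fin n → Fin m → Bool

∑ : ∀ {m} → (Fin m → ℚ) → ℚ
∑ {zero}  f = 0ℚ
∑ {suc m} f = f zero ℚ.+ ∑ (λ i → f (suc i))

nbSum : ∀ {n m} → Adj n m → Fin n → (Fin m → ℚ) → ℚ
nbSum adj u x = ∑ (λ v → if adj u v then x v else 0ℚ)
  where open import Data.Bool using (if_then_else_)

ℤtoℚ : ℤ → ℚ
ℤtoℚ z = z ℚ./ 1

wSum : ∀ {m} → (Fin m → ℤ) → (Fin m → ℚ) → ℚ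
wSum f x = ∑ (λ v → ℤtoℚ (f v) ℚ.* x v)

BaseFeasible : ∀ {n m} → Adj n m → (Fin m → ℚ) → Set
BaseFeasible {n} {m} adj x =
  ((u : Fin n) → 1ℚ ≤ nbSum adj u x) × ((v : Fin m) → (0ℚ ≤ x v) × (x v ≤ 1ℚ))

-- Extended value: a rational, or +∞ (used for infeasible LPs)
ℚ∞ : Set
ℚ∞ = ℚ ⊎ ⊤

IsOptimal : ∀ {m} → ((Fin m → ℚ) → Set) → ((Fin m → ℚ) → ℚ) → ℚ∞ → Set
IsOptimal {m} Feas obj (inj₁ q) =
  (Σ (Fin m → ℚ) λ x → Feas x × obj x ≡ q) × ((x : Fin m → ℚ) → Feas x → q ≤ obj x)
IsOptimal {m} Feas obj (inj₂ _) = (x : Fin m → ℚ) → ¬ Feas x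

AtLeastCeil : ℚ∞ → ℚ → Set
AtLeastCeil (inj₁ q) t = ℤtoℚ (ceiling q) ≤ t
AtLeastCeil (inj₂ _) t = ⊥

FeasLP : ∀ {n m k} → Adj n m → ℚ → (Fin k → Fin m → ℤ) → (Fin k → ℚ∞) →
         Fin k → (Fin m → ℚ) → Set
FeasLP {k = k} adj sol f sols j x =
  BaseFeasible adj x ×
  (∑ x ≡ ℤtoℚ (ceiling sol)) ×
  ((i : Fin k) → toℕ i Data.Nat.< toℕ j → AtLeastCeil (sols i) (wSum (f i) x))
  where import Data.Nat

open import Data.Fin.Subset using (Subset; _∈_)
IsPDS : ∀ {n m} → Adj n m → Subset m → Set
IsPDS {n} {m} adj D = (u : Fin n) → ∃ λ (v : Fin m) → v ∈ D × adj u v ≡ true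

{-# OPTIONS --safe #-}
-- The indicator vector x of a UD-PDS D is feasible for the base LP, so ⌈sol⌉ ≤ |D|.  If |D| = ⌈sol⌉,
-- then x is feasible for every LP(f_j), by strong induction on j: it meets the cardinality
-- constraint, and for i < j it is feasible for LP(f_i), so sol_i is finite and at most the integer
-- ∑ f_i(v) x_v, whence so is ⌈sol_i⌉.  This contradicts the infeasibility of some LP(f_j).
module Submission where

open import Defs
open import Data.Nat using (ℕ; _≤_)
open import Data.Fin using (Fin)
open import Data.Fin.Subset using (Subset; ∣_∣)
open import Data.Bool using (true)
open import Data.Integer using (ℤ; +_)
open import Data.Rational using (ℚ; ceiling)
open import Data.Sum using (inj₁; inj₂)
open import Data.Unit using (tt)
open import Data.Product using (∃; _×_)
open import Relation.Binary.PropositionalEquality using (_≡_)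

open import Level using (0ℓ)
open import Data.Nat as ℕ using (zero; suc)
open import Data.Fin using (zero; suc)
open import Data.Fin.Induction using (<-wellFounded)
open import Data.Fin.Subset using (_∈_)
open import Data.Bool using (false; if_then_else_)
open import Data.Integer as ℤ using (-[1+_]; 1ℤ)
import Data.Integer.Properties as ℤP
import Data.Integer.DivMod as ℤD
open import Data.Rational as ℚ using (mkℚ; 0ℚ; 1ℚ; *≤*; floor; -_)
import Data.Rational.Properties as ℚP
import Data.Nat.Coprimality as Coprime
open Coprime using (1-coprimeTo)
open import Data.Vec using ([]; _∷_; lookup)
open import Data.Vec.Properties using ([]=⇒lookup)
open import Data.Product using (_,_; proj₁)
open import Function using (_∘_)
open import Induction.WellFounded as WF using (WfRec)
open import Relation.Binary.PropositionalEquality using (_≢_; refl; sym; trans; cong; cong₂; subst; subst₂)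

ℤtoℚ≡mkℚ : ∀ z → ℤtoℚ z ≡ mkℚ z 0 (Coprime.sym (1-coprimeTo ℤ.∣ z ∣))
ℤtoℚ≡mkℚ z = ℚP.↥p/↧p≡p (mkℚ z 0 _)

-- On denominator 1, ℚ's _+_ and _*_ unfold to (a * 1 + b * 1) / 1 and (a * b) / 1.
ℤtoℚ-+ : ∀ a b → ℤtoℚ (a ℤ.+ b) ≡ ℤtoℚ a ℚ.+ ℤtoℚ b
ℤtoℚ-+ a b rewrite ℤtoℚ≡mkℚ a | ℤtoℚ≡mkℚ b =
  cong ℤtoℚ (sym (cong₂ ℤ._+_ (ℤP.*-identityʳ a) (ℤP.*-identityʳ b)))

ℤtoℚ-* : ∀ a b → ℤtoℚ (a ℤ.* b) ≡ ℤtoℚ a ℚ.* ℤtoℚ b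
ℤtoℚ-* a b rewrite ℤtoℚ≡mkℚ a | ℤtoℚ≡mkℚ b = refl

ℤtoℚ-neg : ∀ z → ℤtoℚ (ℤ.- z) ≡ - ℤtoℚ z
ℤtoℚ-neg z rewrite ℤtoℚ≡mkℚ z | ℤtoℚ≡mkℚ (ℤ.- z) with z
... | + zero = refl
... | + suc _ = refl
... | -[1+ _ ] = refl

ℤtoℚ-mono-≤ : ∀ {a b} → a ℤ.≤ b → ℤtoℚ a ℚ.≤ ℤtoℚ b
ℤtoℚ-mono-≤ {a} {b} a≤b rewrite ℤtoℚ≡mkℚ a | ℤtoℚ≡mkℚ b =
  *≤* (subst₂ ℤ._≤_ (sym (ℤP.*-identityʳ a)) (sym (ℤP.*-identityʳ b)) a≤b)

≤-/ℕ : ∀ z n d .{{_ : ℕ.NonZero d}} → z ℤ.* + d ℤ.≤ n → z ℤ.≤ n ℤD./ℕ d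
≤-/ℕ z n d z*d≤n = subst (z ℤ.≤_) (ℤP.pred-suc (n ℤD./ℕ d))
  (ℤP.i<j⇒i≤pred[j] (ℤP.*-cancelʳ-<-nonNeg {z} {ℤ.suc (n ℤD./ℕ d)} (+ d) (ℤP.≤-<-trans z*d≤n (ℤD.n<s[n/ℕd]*d n d))))

≤-floor : ∀ z q → ℤtoℚ z ℚ.≤ q → z ℤ.≤ floor q
≤-floor z (mkℚ n d _) z≤q rewrite ℤtoℚ≡mkℚ z with z≤q
... | *≤* z*d≤n*1 = subst (z ℤ.≤_) (sym (ℤD.div-pos-is-/ℕ n (suc d)))
        (≤-/ℕ z n (suc d) (subst (z ℤ.* + suc d ℤ.≤_) (ℤP.*-identityʳ n) z*d≤n*1))

ceiling-≤ : ∀ q z → q ℚ.≤ ℤtoℚ z → ceiling q ℤ.≤ z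
ceiling-≤ q@record{} z q≤z = subst (ℤ.- floor (- q) ℤ.≤_) (ℤP.neg-involutive z)
  (ℤP.neg-mono-≤ (≤-floor (ℤ.- z) (- q) (subst (ℚ._≤ - q) (sym (ℤtoℚ-neg z)) (ℚP.neg-antimono-≤ q≤z))))

IsInteger : ℚ → Set
IsInteger q = ∃ λ z → ℤtoℚ z ≡ q

IsInteger-+ : ∀ {p q} → IsInteger p → IsInteger q → IsInteger (p ℚ.+ q)
IsInteger-+ (a , a≡p) (b , b≡q) = a ℤ.+ b , trans (ℤtoℚ-+ a b) (cong₂ ℚ._+_ a≡p b≡q)

IsInteger-* : ∀ {p q} → IsInteger p → IsInteger q → IsInteger (p ℚ.* q)
IsInteger-* (a , a≡p) (b , b≡q) = a ℤ.* b , trans (ℤtoℚ-* a b) (cong₂ ℚ._*_ a≡p b≡q)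

IsInteger-∑ : ∀ {m} {g : Fin m → ℚ} → (∀ v → IsInteger (g v)) → IsInteger (∑ g)
IsInteger-∑ {zero}  _   = + 0 , refl
IsInteger-∑ {suc m} int = IsInteger-+ (int zero) (IsInteger-∑ (int ∘ suc))

IsInteger-wSum : ∀ {m} (w : Fin m → ℤ) {x : Fin m → ℚ} → (∀ v → IsInteger (x v)) → IsInteger (wSum w x)
IsInteger-wSum w int = IsInteger-∑ (λ v → IsInteger-* (w v , refl) (int v))

∑-nonNeg : ∀ {m} (g : Fin m → ℚ) → (∀ v → 0ℚ ℚ.≤ g v) → 0ℚ ℚ.≤ ∑ g
∑-nonNeg {zero}  g _   = ℚP.≤-refl
∑-nonNeg {suc m} g g≥0 = ℚP.+-mono-≤ (g≥0 zero) (∑-nonNeg (g ∘ suc) (g≥0 ∘ suc))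

term≤∑ : ∀ {m} (g : Fin m → ℚ) → (∀ v → 0ℚ ℚ.≤ g v) → ∀ v → g v ℚ.≤ ∑ g
term≤∑ g g≥0 zero    = subst (ℚ._≤ ∑ g) (ℚP.+-identityʳ (g zero))
  (ℚP.+-monoʳ-≤ (g zero) (∑-nonNeg (g ∘ suc) (g≥0 ∘ suc)))
term≤∑ g g≥0 (suc v) = subst (ℚ._≤ ∑ g) (ℚP.+-identityˡ (g (suc v)))
  (ℚP.+-mono-≤ (g≥0 zero) (term≤∑ (g ∘ suc) (g≥0 ∘ suc) v))

indicator : ∀ {m} → Subset m → Fin m → ℚ
indicator D v = if lookup D v then 1ℚ else 0ℚ

∑-indicator : ∀ {m} (D : Subset m) → ∑ (indicator D) ≡ ℤtoℚ (+ ∣ D ∣)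
∑-indicator []          = refl
∑-indicator (true ∷ D)  = trans (cong (1ℚ ℚ.+_) (∑-indicator D)) (sym (ℤtoℚ-+ (+ 1) (+ ∣ D ∣)))
∑-indicator (false ∷ D) = trans (ℚP.+-identityˡ _) (∑-indicator D)

IsInteger-indicator : ∀ {m} (D : Subset m) v → IsInteger (indicator D v)
IsInteger-indicator D v with lookup D v
... | true  = + 1 , refl
... | false = + 0 , refl

indicator-bounds : ∀ {m} (D : Subset m) v → (0ℚ ℚ.≤ indicator D v) × (indicator D v ℚ.≤ 1ℚ)
indicator-bounds D v with lookup D v
... | true  = ℚP.nonNegative⁻¹ 1ℚ , ℚP.≤-refl
... | false = ℚP.≤-refl , ℚP.nonNegative⁻¹ 1ℚ

PDS⇒BaseFeasible : ∀ {n m} (adj : Adj n m) (D : Subset m) → IsPDS adj D → BaseFeasible adj (indicator D)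
PDS⇒BaseFeasible {n} {m} adj D pds = dominated , indicator-bounds D
  where
  term : Fin n → Fin m → ℚ
  term u v = if adj u v then indicator D v else 0ℚ

  term-nonNeg : ∀ u v → 0ℚ ℚ.≤ term u v
  term-nonNeg u v with adj u v
  ... | true  = proj₁ (indicator-bounds D v)
  ... | false = ℚP.≤-refl

  term≡1 : ∀ {u v} → v ∈ D → adj u v ≡ true → term u v ≡ 1ℚ
  term≡1 v∈D uv rewrite uv | []=⇒lookup v∈D = refl

  dominated : ∀ u → 1ℚ ℚ.≤ nbSum adj u (indicator D)
  dominated u with pds u
  ... | v , v∈D , uv = subst (ℚ._≤ nbSum adj u (indicator D)) (term≡1 v∈D uv) (term≤∑ (term u) (term-nonNeg u) v)

integral-feasible⇒AtLeastCeil : ∀ {m} {Feas : (Fin m → ℚ) → Set} {obj : (Fin m → ℚ) → ℚ} {s x} →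
  IsOptimal Feas obj s → Feas x → IsInteger (obj x) → AtLeastCeil s (obj x)
integral-feasible⇒AtLeastCeil {s = inj₁ q} (_ , q-minimal) feasible (z , z≡obj) =
  subst (ℤtoℚ (ceiling q) ℚ.≤_) z≡obj
    (ℤtoℚ-mono-≤ (ceiling-≤ q z (subst (q ℚ.≤_) (sym z≡obj) (q-minimal _ feasible))))
integral-feasible⇒AtLeastCeil {s = inj₂ _} infeasible feasible _ = infeasible _ feasible

integral-feasible⇒FeasLP : ∀ {n m k} {adj : Adj n m} {sol : ℚ} {f : Fin k → Fin m → ℤ} {sols : Fin k → ℚ∞} →
  (∀ j → IsOptimal (FeasLP adj sol f sols j) (wSum (f j)) (sols j)) →
  ∀ {x} → BaseFeasible adj x → ∑ x ≡ ℤtoℚ (ceiling sol) → (∀ i → IsInteger (wSum (f i) x)) →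
  ∀ j → FeasLP adj sol f sols j x
integral-feasible⇒FeasLP {adj = adj} {sol} {f} {sols} optimal {x} base total integral =
  WF.All.wfRec <-wellFounded 0ℓ Feasible feasible-below⇒feasible
  where
  Feasible : Fin _ → Set
  Feasible j = FeasLP adj sol f sols j x

  feasible-below⇒feasible : ∀ j → WfRec Data.Fin._<_ Feasible j → Feasible j
  feasible-below⇒feasible j feasible-below = base , total ,
    λ i i<j → integral-feasible⇒AtLeastCeil (optimal i) (feasible-below i<j) (integral i)

mainTheorem2 : (n m : ℕ) (adj : Adj n m) →
    ((u : Fin n) → ∃ λ (v : Fin m) → adj u v ≡ true) →
    (sol : ℚ) → IsOptimal (BaseFeasible adj) ∑ (inj₁ sol) →
    (k : ℕ) → 1 ≤ k → (f : Fin k → Fin m → ℤ) →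
    (sols : Fin k → ℚ∞) →
    ((j : Fin k) → IsOptimal (FeasLP adj sol f sols j) (wSum (f j)) (sols j)) →
    (∃ λ (j : Fin k) → sols j ≡ inj₂ tt) →
    (D : Subset m) → IsPDS adj D →
    Data.Integer._≤_ (ceiling sol Data.Integer.+ + 1) (+ ∣ D ∣)
mainTheorem2 n m adj _ sol (_ , sol-minimal) k _ f sols sols-optimal (j , solsⱼ≡∞) D pds =
  subst (ℤ._≤ + ∣ D ∣) (ℤP.+-comm 1ℤ (ceiling sol)) (ℤP.i<j⇒suc[i]≤j (ℤP.≤∧≢⇒< ⌈sol⌉≤∣D∣ ⌈sol⌉≢∣D∣))
  where
  x-feasible : BaseFeasible adj (indicator D)
  x-feasible = PDS⇒BaseFeasible adj D pds

  ⌈sol⌉≤∣D∣ : ceiling sol ℤ.≤ + ∣ D ∣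
  ⌈sol⌉≤∣D∣ = ceiling-≤ sol _ (subst (sol ℚ.≤_) (∑-indicator D) (sol-minimal _ x-feasible))

  ⌈sol⌉≢∣D∣ : ceiling sol ≢ + ∣ D ∣
  ⌈sol⌉≢∣D∣ ⌈sol⌉≡∣D∣ = subst (IsOptimal _ _) solsⱼ≡∞ (sols-optimal j) (indicator D)
    (integral-feasible⇒FeasLP {sol = sol} {f = f} sols-optimal x-feasible
      (trans (∑-indicator D) (cong ℤtoℚ (sym ⌈sol⌉≡∣D∣)))
      (λ i → IsInteger-wSum (f i) (IsInteger-indicator D)) j)
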